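{- Let $G$ be a connected $\{K_{1,3},Z_{2},N\}$-free graph which contains an induced subgraph $H=H_{6}$. Then for each vertex $a\in V(G)\setminus V(H)$ with $N_{G}(a)\cap V(H)\neq\emptyset$, $N_{G}(a)\cap V(H)=\{x_{i},x_{i+1},x_{7}\}$ for some $i\in\{1,3\}$. Consequently, $G[V(H)\cup\{a\}]\cong H_{7}$.
   Context: All graphs are finite and simple; $N_G(a)$ is the neighborhood of $a$, $G[X]$ the induced subgraph. $\mathcal{F}$-free means no member of $\mathcal{F}$ is an induced subgraph. $K_{1,3}$ is the star with three leaves; $Z_2$ is a triangle $abc$ plus a path $ade$ on new vertices $d,e$; $N$ is a triangle with one new pendant vertex attached to each of its three vertices. $H_6$: vertices $x_1,\dots,x_7$, edges $x_1x_2,x_1x_3,x_1x_5,x_3x_5,x_3x_4,x_2x_4,x_2x_6,x_4x_6,x_5x_6,x_5x_7,x_6x_7$; the induced subgraph $H$ is identified with $H_6$ via these labels. $H_7$: vertices $y_1,\dots,y_8$, edges $y_1y_2,y_1y_3,y_1y_5,y_2y_4,y_2y_6,y_3y_4,y_3y_5,y_3y_7,y_4y_6,y_4y_7,y_5y_6,y_5y_8,y_6y_8,y_7y_8$. -}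

module Defs where

open import Data.Nat using (ℕ)
open import Data.Fin using (Fin; zero; suc; _≟_; #_; inject₁)
open import Data.Bool using (Bool; true; false; _∨_; _∧_)
open import Data.Bool.Properties using (∨-comm)
open import Data.List using (List; []; _∷_)
open import Data.Product using (_×_; _,_; Σ; ∃)
open import Relation.Nullary using (¬_)
open import Relation.Nullary.Decidable using (⌊_⌋)
open import Relation.Binary.PropositionalEquality using (_≡_; refl)
open import Function.Definitions using (Injective)

record Graph : Set where
  field
    n      : ℕ
    adj    : Fin n → Fin n → Bool
    sym    : ∀ u v → adj u v ≡ adj v u
    irrefl : ∀ v → adj v v ≡ false

open Graph public

V : Graph → Set
V G = Fin (n G)

data Reach (G : Graph) (u : V G) : V G → Set where
  here : Reach G u u
  step : ∀ {v w} → Reach G u v → adj G v w ≡ true → Reach G u w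

Connected : Graph → Set
Connected G = ∀ u v → Reach G u v

record InducedEmb (P G : Graph) : Set where
  field
    f   : V P → V G
    inj : Injective _≡_ _≡_ f
    pres : ∀ i j → adj G (f i) (f j) ≡ adj P i j

open InducedEmb public

Free : Graph → Graph → Set
Free P G = ¬ InducedEmb P G

memE : {k : ℕ} → List (Fin k × Fin k) → Fin k → Fin k → Bool
memE [] i j = false
memE ((a , b) ∷ es) i j = (⌊ a ≟ i ⌋ ∧ ⌊ b ≟ j ⌋) ∨ memE es i j

edgeAdj : {k : ℕ} → List (Fin k × Fin k) → Fin k → Fin k → Bool
edgeAdj es i j = memE es i j ∨ memE es j i

edgeAdj-sym : {k : ℕ} (es : List (Fin k × Fin k)) → ∀ i j → edgeAdj es i j ≡ edgeAdj es j i
edgeAdj-sym es i j = ∨-comm (memE es i j) (memE es j i)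

-- Small graphs from edge lists; irreflexivity checked by exhaustion.
-- Vertex label x_k / y_k of the paper is  # (k - 1).

K13 : Graph
K13 = record { n = 4 ; adj = edgeAdj es ; sym = edgeAdj-sym es ; irrefl = ir }
  where
  es : List (Fin 4 × Fin 4)
  es = (# 0 , # 1) ∷ (# 0 , # 2) ∷ (# 0 , # 3) ∷ []
  ir : ∀ v → edgeAdj es v v ≡ false
  ir zero = refl
  ir (suc zero) = refl
  ir (suc (suc zero)) = refl
  ir (suc (suc (suc zero))) = refl

Z2 : Graph
Z2 = record { n = 5 ; adj = edgeAdj es ; sym = edgeAdj-sym es ; irrefl = ir }
  where
  es : List (Fin 5 × Fin 5)
  es = (# 0 , # 1) ∷ (# 1 , # 2) ∷ (# 0 , # 2) ∷ (# 0 , # 3) ∷ (# 3 , # 4) ∷ []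
  ir : ∀ v → edgeAdj es v v ≡ false
  ir zero = refl
  ir (suc zero) = refl
  ir (suc (suc zero)) = refl
  ir (suc (suc (suc zero))) = refl
  ir (suc (suc (suc (suc zero)))) = refl

Net : Graph
Net = record { n = 6 ; adj = edgeAdj es ; sym = edgeAdj-sym es ; irrefl = ir }
  where
  es : List (Fin 6 × Fin 6)
  es = (# 0 , # 1) ∷ (# 1 , # 2) ∷ (# 0 , # 2) ∷ (# 0 , # 3) ∷ (# 1 , # 4) ∷ (# 2 , # 5) ∷ []
  ir : ∀ v → edgeAdj es v v ≡ false
  ir zero = refl
  ir (suc zero) = refl
  ir (suc (suc zero)) = refl
  ir (suc (suc (suc zero))) = refl
  ir (suc (suc (suc (suc zero)))) = refl
  ir (suc (suc (suc (suc (suc zero))))) = refl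

H6 : Graph
H6 = record { n = 7 ; adj = edgeAdj es ; sym = edgeAdj-sym es ; irrefl = ir }
  where
  es : List (Fin 7 × Fin 7)
  es = (# 0 , # 1) ∷ (# 0 , # 2) ∷ (# 0 , # 4) ∷ (# 2 , # 4) ∷ (# 2 , # 3) ∷
       (# 1 , # 3) ∷ (# 1 , # 5) ∷ (# 3 , # 5) ∷ (# 4 , # 5) ∷ (# 4 , # 6) ∷
       (# 5 , # 6) ∷ []
  ir : ∀ v → edgeAdj es v v ≡ false
  ir zero = refl
  ir (suc zero) = refl
  ir (suc (suc zero)) = refl
  ir (suc (suc (suc zero))) = refl
  ir (suc (suc (suc (suc zero)))) = refl
  ir (suc (suc (suc (suc (suc zero))))) = refl
  ir (suc (suc (suc (suc (suc (suc zero)))))) = refl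

H7 : Graph
H7 = record { n = 8 ; adj = edgeAdj es ; sym = edgeAdj-sym es ; irrefl = ir }
  where
  es : List (Fin 8 × Fin 8)
  es = (# 0 , # 1) ∷ (# 0 , # 2) ∷ (# 0 , # 4) ∷ (# 1 , # 3) ∷ (# 1 , # 5) ∷
       (# 2 , # 3) ∷ (# 2 , # 4) ∷ (# 2 , # 6) ∷ (# 3 , # 5) ∷ (# 3 , # 6) ∷
       (# 4 , # 5) ∷ (# 4 , # 7) ∷ (# 5 , # 7) ∷ (# 6 , # 7) ∷ []
  ir : ∀ v → edgeAdj es v v ≡ false
  ir zero = refl
  ir (suc zero) = refl
  ir (suc (suc zero)) = refl
  ir (suc (suc (suc zero))) = refl
  ir (suc (suc (suc (suc zero)))) = refl
  ir (suc (suc (suc (suc (suc zero))))) = refl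
  ir (suc (suc (suc (suc (suc (suc zero)))))) = refl
  ir (suc (suc (suc (suc (suc (suc (suc zero))))))) = refl

-- Here i : Fin 6 with the paper's x_i being  inject₁ i  and x_{i+1} being  suc i
-- (so the paper's i = 1 is  # 0  and the paper's i = 3 is  # 2).
NbrSet : Fin 6 → Fin 7 → Bool
NbrSet i k = ⌊ k ≟ inject₁ i ⌋ ∨ ⌊ k ≟ suc i ⌋ ∨ ⌊ k ≟ # 6 ⌋

module Submission where

-- A vertex a outside H is determined, up to isomorphism of G[V(H) ∪ {a}], by
-- the set of its neighbours in H, so the lemma is a finite check over the
-- 2⁷ possible neighbourhoods: every one except ∅, {x₁, x₂, x₇} and
-- {x₃, x₄, x₇} already yields an induced claw or Z₂ inside H + a, and for the
-- two survivors H + a is isomorphic to H₇.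

open import Defs hiding (sym)
open import Data.Bool using (Bool; true; false)
open import Data.Bool.Properties using (_≟_)
open import Data.Empty using (⊥-elim)
open import Data.Fin using (Fin; #_; zero; suc)
import Data.Nat as ℕ
import Data.Fin.Properties as Fin
open import Data.Product using (Σ; ∃; _×_; _,_)
open import Data.Sum using (_⊎_; inj₁; inj₂)
open import Data.Vec using (Vec; []; _∷_; lookup; tabulate)
open import Data.Vec.Properties using (lookup∘tabulate)
import Function.Properties.Equivalence as ⇔
open import Function.Bundles using (_⇔_; mk⇔)
open import Relation.Nullary using (¬_; Dec)
open import Relation.Nullary.Decidable using (True; toWitness; _→-dec_)
open import Relation.Binary.PropositionalEquality
  using (_≡_; _≢_; refl; sym; trans; cong; module ≡-Reasoning)

private
  variable
    P Q G : Graph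

tabulate-injective : ∀ {a} {A : Set a} {m} {g h : Fin m → A} →
  tabulate g ≡ tabulate h → ∀ i → g i ≡ h i
tabulate-injective {g = g} {h} e i = begin
  g i                   ≡⟨ lookup∘tabulate g i ⟨
  lookup (tabulate g) i ≡⟨ cong (λ v → lookup v i) e ⟩
  lookup (tabulate h) i ≡⟨ lookup∘tabulate h i ⟩
  h i                   ∎
  where open ≡-Reasoning

induced-trans : InducedEmb P Q → InducedEmb Q G → InducedEmb P G
induced-trans E F = record
  { f    = λ i → f F (f E i)
  ; inj  = λ e → inj E (inj F e)
  ; pres = λ i j → trans (pres F (f E i) (f E j)) (pres E i j)
  }

Image : InducedEmb P G → V G → Set
Image E v = ∃ λ i → f E i ≡ v

induced-trans-image : (E : InducedEmb P Q) → (∀ w → Image E w) →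
  (F : InducedEmb Q G) → ∀ v → Image (induced-trans E F) v ⇔ Image F v
induced-trans-image E onto F v = mk⇔ (λ (i , e) → f E i , e) from
  where
  from : Image F v → Image (induced-trans E F) v
  from (w , e) with onto w
  ... | i , refl = i , e

extend : (P : Graph) → (V P → Bool) → Graph
extend P b = record { n = ℕ.suc (n P) ; adj = adj⁺ ; sym = sym⁺ ; irrefl = irrefl⁺ }
  where
  adj⁺ : Fin (ℕ.suc (n P)) → Fin (ℕ.suc (n P)) → Bool
  adj⁺ zero    zero    = false
  adj⁺ zero    (suc j) = b j
  adj⁺ (suc i) zero    = b i
  adj⁺ (suc i) (suc j) = adj P i j

  sym⁺ : ∀ i j → adj⁺ i j ≡ adj⁺ j i
  sym⁺ zero    zero    = refl
  sym⁺ zero    (suc j) = refl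
  sym⁺ (suc i) zero    = refl
  sym⁺ (suc i) (suc j) = Graph.sym P i j

  irrefl⁺ : ∀ i → adj⁺ i i ≡ false
  irrefl⁺ zero    = refl
  irrefl⁺ (suc i) = irrefl P i

neighboursIn : InducedEmb P G → V G → V P → Bool
neighboursIn {G = G} H a k = adj G a (f H k)

module _ (H : InducedEmb P G) (a : V G) (a∉H : ∀ k → f H k ≢ a)
         (b : V P → Bool) (a∼b : ∀ k → neighboursIn H a k ≡ b k) where

  extend-map : V (extend P b) → V G
  extend-map zero    = a
  extend-map (suc k) = f H k

  extend-map-injective : ∀ {i j} → extend-map i ≡ extend-map j → i ≡ j
  extend-map-injective {zero}  {zero}  e = refl
  extend-map-injective {zero}  {suc j} e = ⊥-elim (a∉H j (sym e))
  extend-map-injective {suc i} {zero}  e = ⊥-elim (a∉H i e)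
  extend-map-injective {suc i} {suc j} e = cong suc (inj H e)

  extend-map-pres : ∀ i j → adj G (extend-map i) (extend-map j) ≡ adj (extend P b) i j
  extend-map-pres zero    zero    = irrefl G a
  extend-map-pres zero    (suc j) = a∼b j
  extend-map-pres (suc i) zero    = trans (Graph.sym G (f H i) a) (a∼b i)
  extend-map-pres (suc i) (suc j) = pres H i j

  extendEmb : InducedEmb (extend P b) G
  extendEmb = record { f = extend-map ; inj = extend-map-injective ; pres = extend-map-pres }

  extendEmb-image : ∀ v → Image extendEmb v ⇔ (Image H v ⊎ v ≡ a)
  extendEmb-image v = mk⇔ to from
    where
    to : Image extendEmb v → Image H v ⊎ v ≡ a
    to (zero  , e) = inj₂ (sym e)
    to (suc k , e) = inj₁ (k , e)

    from : Image H v ⊎ v ≡ a → Image extendEmb v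
    from (inj₁ (k , e)) = suc k , e
    from (inj₂ e)       = zero , sym e

-- For a concrete vector φ the implicit True arguments below are discharged by
-- evaluation, so an embedding between small graphs is given by its images alone.
module _ {P Q : Graph} (φ : Vec (V Q) (n P)) where

  injective? : Dec (∀ i j → lookup φ i ≡ lookup φ j → i ≡ j)
  injective? = Fin.all? λ i → Fin.all? λ j → (lookup φ i Fin.≟ lookup φ j) →-dec (i Fin.≟ j)

  preserving? : Dec (∀ i j → adj Q (lookup φ i) (lookup φ j) ≡ adj P i j)
  preserving? = Fin.all? λ i → Fin.all? λ j → adj Q (lookup φ i) (lookup φ j) ≟ adj P i j

  surjective? : Dec (∀ v → ∃ λ i → lookup φ i ≡ v)
  surjective? = Fin.all? λ v → Fin.any? λ i → lookup φ i Fin.≟ v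

  fromVec : {True injective?} → {True preserving?} → InducedEmb P Q
  fromVec {i?} {p?} = record
    { f    = lookup φ
    ; inj  = λ {i} {j} → toWitness i? i j
    ; pres = toWitness p?
    }

  isoFromVec : {True injective?} → {True preserving?} → {True surjective?} →
    Σ (InducedEmb P Q) λ E → ∀ v → Image E v
  isoFromVec {i?} {p?} {s?} = fromVec {i?} {p?} , toWitness s?

extendEmb-tabulated : (H : InducedEmb P G) (a : V G) → (∀ k → f H k ≢ a) →
  InducedEmb (extend P (lookup (tabulate (neighboursIn H a)))) G
extendEmb-tabulated H a a∉H = extendEmb H a a∉H _ (λ k → sym (lookup∘tabulate (neighboursIn H a) k))

data Attachment (b : Vec Bool 7) : Set where
  detached : b ≡ tabulate (λ _ → false) → Attachment b
  attached : (i : Fin 6) → i ≡ # 0 ⊎ i ≡ # 2 → b ≡ tabulate (NbrSet i) → Attachment b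
  claw     : InducedEmb K13 (extend H6 (lookup b)) → Attachment b
  z₂       : InducedEmb Z2  (extend H6 (lookup b)) → Attachment b

-- A decision tree on the adjacency of the new vertex (index 0) to x₁, …, x₇
-- (indices 1, …, 7); each forbidden subgraph only reads the bits fixed in its clause.
classify : (b : Vec Bool 7) → Attachment b
classify (false ∷ false ∷ false ∷ false ∷ false ∷ false ∷ false ∷ []) = detached refl
classify (false ∷ false ∷ false ∷ false ∷ false ∷ false ∷ true ∷ [])  = z₂ (fromVec (# 5 ∷ # 1 ∷ # 3 ∷ # 7 ∷ # 0 ∷ []))
classify (false ∷ false ∷ false ∷ true ∷ false ∷ false ∷ _ ∷ [])      = claw (fromVec (# 4 ∷ # 0 ∷ # 2 ∷ # 3 ∷ []))
classify (false ∷ false ∷ true ∷ false ∷ false ∷ false ∷ _ ∷ [])      = claw (fromVec (# 3 ∷ # 0 ∷ # 1 ∷ # 4 ∷ []))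
classify (false ∷ false ∷ true ∷ true ∷ false ∷ false ∷ false ∷ [])   = z₂ (fromVec (# 3 ∷ # 0 ∷ # 4 ∷ # 5 ∷ # 7 ∷ []))
classify (false ∷ false ∷ true ∷ true ∷ false ∷ false ∷ true ∷ [])    = attached (# 2) (inj₂ refl) refl
classify (false ∷ false ∷ _ ∷ _ ∷ false ∷ true ∷ _ ∷ [])              = claw (fromVec (# 6 ∷ # 0 ∷ # 2 ∷ # 5 ∷ []))
classify (false ∷ true ∷ _ ∷ false ∷ false ∷ _ ∷ _ ∷ [])              = claw (fromVec (# 2 ∷ # 0 ∷ # 1 ∷ # 4 ∷ []))
classify (false ∷ true ∷ _ ∷ true ∷ false ∷ _ ∷ _ ∷ [])               = z₂ (fromVec (# 2 ∷ # 0 ∷ # 4 ∷ # 1 ∷ # 5 ∷ []))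
classify (false ∷ _ ∷ _ ∷ _ ∷ true ∷ false ∷ _ ∷ [])                  = claw (fromVec (# 5 ∷ # 0 ∷ # 1 ∷ # 6 ∷ []))
classify (false ∷ _ ∷ _ ∷ _ ∷ true ∷ true ∷ false ∷ [])               = claw (fromVec (# 5 ∷ # 0 ∷ # 1 ∷ # 7 ∷ []))
classify (false ∷ false ∷ _ ∷ _ ∷ true ∷ true ∷ true ∷ [])            = z₂ (fromVec (# 5 ∷ # 0 ∷ # 7 ∷ # 1 ∷ # 2 ∷ []))
classify (false ∷ true ∷ false ∷ _ ∷ true ∷ true ∷ true ∷ [])         = z₂ (fromVec (# 2 ∷ # 0 ∷ # 6 ∷ # 1 ∷ # 3 ∷ []))
classify (false ∷ true ∷ true ∷ _ ∷ true ∷ true ∷ true ∷ [])          = claw (fromVec (# 0 ∷ # 2 ∷ # 3 ∷ # 7 ∷ []))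
classify (true ∷ false ∷ _ ∷ _ ∷ false ∷ _ ∷ _ ∷ [])                  = claw (fromVec (# 1 ∷ # 0 ∷ # 2 ∷ # 5 ∷ []))
classify (true ∷ true ∷ _ ∷ _ ∷ false ∷ _ ∷ false ∷ [])               = z₂ (fromVec (# 1 ∷ # 0 ∷ # 2 ∷ # 5 ∷ # 7 ∷ []))
classify (true ∷ true ∷ false ∷ false ∷ false ∷ false ∷ true ∷ [])    = attached (# 0) (inj₁ refl) refl
classify (true ∷ true ∷ false ∷ false ∷ false ∷ true ∷ true ∷ [])     = claw (fromVec (# 6 ∷ # 0 ∷ # 4 ∷ # 5 ∷ []))
classify (true ∷ true ∷ false ∷ true ∷ false ∷ _ ∷ true ∷ [])         = claw (fromVec (# 0 ∷ # 1 ∷ # 4 ∷ # 7 ∷ []))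
classify (true ∷ true ∷ true ∷ _ ∷ false ∷ _ ∷ true ∷ [])             = claw (fromVec (# 0 ∷ # 2 ∷ # 3 ∷ # 7 ∷ []))
classify (true ∷ _ ∷ false ∷ _ ∷ true ∷ _ ∷ false ∷ [])               = claw (fromVec (# 5 ∷ # 0 ∷ # 3 ∷ # 7 ∷ []))
classify (true ∷ false ∷ true ∷ _ ∷ true ∷ false ∷ false ∷ [])        = z₂ (fromVec (# 1 ∷ # 0 ∷ # 3 ∷ # 2 ∷ # 6 ∷ []))
classify (true ∷ true ∷ true ∷ _ ∷ true ∷ false ∷ false ∷ [])         = z₂ (fromVec (# 2 ∷ # 0 ∷ # 1 ∷ # 6 ∷ # 7 ∷ []))
classify (true ∷ _ ∷ true ∷ _ ∷ true ∷ true ∷ false ∷ [])             = z₂ (fromVec (# 0 ∷ # 1 ∷ # 3 ∷ # 6 ∷ # 7 ∷ []))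
classify (true ∷ false ∷ _ ∷ false ∷ true ∷ _ ∷ true ∷ [])            = z₂ (fromVec (# 1 ∷ # 0 ∷ # 5 ∷ # 2 ∷ # 4 ∷ []))
classify (true ∷ true ∷ _ ∷ false ∷ true ∷ _ ∷ true ∷ [])             = z₂ (fromVec (# 0 ∷ # 5 ∷ # 7 ∷ # 2 ∷ # 4 ∷ []))
classify (true ∷ _ ∷ _ ∷ true ∷ true ∷ _ ∷ true ∷ [])                 = claw (fromVec (# 0 ∷ # 1 ∷ # 4 ∷ # 7 ∷ []))

H7≅extend-H6 : ∀ i → i ≡ # 0 ⊎ i ≡ # 2 →
  Σ (InducedEmb H7 (extend H6 (NbrSet i))) λ E → ∀ v → Image E v
H7≅extend-H6 _ (inj₁ refl) = isoFromVec (# 0 ∷ # 7 ∷ # 1 ∷ # 5 ∷ # 2 ∷ # 6 ∷ # 3 ∷ # 4 ∷ [])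
H7≅extend-H6 _ (inj₂ refl) = isoFromVec (# 0 ∷ # 7 ∷ # 3 ∷ # 5 ∷ # 4 ∷ # 6 ∷ # 1 ∷ # 2 ∷ [])

lemma2p7 : (G : Graph) → Connected G → Free K13 G → Free Z2 G → Free Net G →
    (H : InducedEmb H6 G) → (a : V G) → (∀ k → ¬ f H k ≡ a) →
    (∃ λ k → adj G a (f H k) ≡ true) →
    (Σ (Fin 6) λ i → (i ≡ # 0 ⊎ i ≡ # 2) × (∀ k → adj G a (f H k) ≡ NbrSet i k))
    × (Σ (InducedEmb H7 G) λ E →
    ∀ v → (∃ λ j → f E j ≡ v) ⇔ ((∃ λ k → f H k ≡ v) ⊎ v ≡ a))
lemma2p7 G _ claw-free z₂-free _ H a a∉H (k , a∼k) with classify (tabulate (neighboursIn H a))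
... | detached e
  with () ← trans (sym a∼k) (tabulate-injective {g = neighboursIn H a} {λ _ → false} e k)
... | claw C = ⊥-elim (claw-free (induced-trans C (extendEmb-tabulated H a a∉H)))
... | z₂ Z   = ⊥-elim (z₂-free (induced-trans Z (extendEmb-tabulated H a a∉H)))
... | attached i i∈ e with H7≅extend-H6 i i∈
...   | E , onto = (i , i∈ , a∼i) , induced-trans E H+a , λ v →
        ⇔.trans (induced-trans-image E onto H+a v) (extendEmb-image H a a∉H _ a∼i v)
  where
  a∼i : ∀ k → neighboursIn H a k ≡ NbrSet i k
  a∼i = tabulate-injective e

  H+a : InducedEmb (extend H6 (NbrSet i)) G
  H+a = extendEmb H a a∉H _ a∼i
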